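{- Let $p$ be a prime with $p\equiv 1 \pmod 4$, and let $a$ be a positive integer with $a<p$ that is a quadratic non-residue modulo $p$. Let $$\Gamma_{p,a}=\left\{\begin{pmatrix} x_0+x_1\sqrt a & \sqrt p\,(x_2+x_3\sqrt a)\\ \sqrt p\,(x_2-x_3\sqrt a) & x_0-x_1\sqrt a\end{pmatrix} \;:\; x_0,x_1,x_2,x_3\in\mathbb{Z},\ x_0^2-ax_1^2-px_2^2+apx_3^2=1\right\}\subset SL(2,\mathbb{R}).$$ Then $\Gamma_{p,a}$ is torsion free as a group of transformations of the upper half-plane, i.e. as a subgroup of $PSL(2,\mathbb{R})$: every element of $\Gamma_{p,a}$ of finite order is equal to $\pm\mathrm{Id}$.
   Context: $\Gamma_{p,a}$ is a group under matrix multiplication (it is the image of the norm-one units of the order $\mathbb{Z}[1,i,j,ij]$ in the quaternion algebra with $i^2=a$, $j^2=p$, $ij=-ji$, and the defining equation is the determinant condition). The paper regards such groups as acting on the upper half-plane $\{z\in\mathbb{C}:\operatorname{Im} z>0\}$ by Möbius transformations $z\mapsto (\alpha z+\beta)/(\gamma z+\delta)$, so that $\pm\mathrm{Id}$ act trivially. -}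

module Defs where

open import Data.Nat as ℕ using (ℕ; suc; zero; _%_)
open import Data.Integer using (ℤ; +_; _+_; _-_; _*_; -_)
open import Data.Product using (∃-syntax)
open import Relation.Binary.PropositionalEquality using (_≡_)
open import Relation.Nullary using (¬_)
open import Data.Integer.Divisibility using (_∣_)

-- An element of Γ_{p,a} is encoded by its integer coordinates (x0,x1,x2,x3),
-- standing for the matrix
--   [ x0 + x1√a          √p (x2 + x3√a) ]
--   [ √p (x2 - x3√a)     x0 - x1√a      ]
-- i.e. the quaternion x0 + x1 i + x2 j + x3 ij with i² = a, j² = p, ij = -ji.
-- This encoding is injective (√a, √p, √(ap) are irrational as a is a
-- non-residue mod p), so equality of coordinates = equality of matrices.
record Mat : Set where
  constructor mat
  field
    x0 x1 x2 x3 : ℤ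

open Mat public

det : ℕ → ℕ → Mat → ℤ
det a p (mat x0 x1 x2 x3) =
  x0 * x0 - (+ a) * (x1 * x1) - (+ p) * (x2 * x2) + (+ a) * (+ p) * (x3 * x3)

-- Matrix product, written in coordinates (it is exactly the 2×2 matrix
-- product of the corresponding real matrices, = quaternion multiplication).
mul : ℕ → ℕ → Mat → Mat → Mat
mul a p (mat x0 x1 x2 x3) (mat y0 y1 y2 y3) = mat
  (x0 * y0 + A * (x1 * y1) + P * (x2 * y2) - A * P * (x3 * y3))
  (x0 * y1 + x1 * y0 - P * (x2 * y3) + P * (x3 * y2))
  (x0 * y2 + x2 * y0 + A * (x1 * y3) - A * (x3 * y1))
  (x0 * y3 + x3 * y0 + x1 * y2 - x2 * y1)
  where
  A = + a
  P = + p

idM : Mat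
idM = mat (+ 1) (+ 0) (+ 0) (+ 0)

negIdM : Mat
negIdM = mat (- (+ 1)) (+ 0) (+ 0) (+ 0)

pow : ℕ → ℕ → Mat → ℕ → Mat
pow a p g zero    = idM
pow a p g (suc n) = mul a p g (pow a p g n)

NonResidue : ℕ → ℕ → Set
NonResidue p a = ¬ (∃[ x ] ((+ p) ∣ (x * x - + a)))

-- Write T = 2x₀ for the trace of g. By Cayley–Hamilton (g² = T·g − Id), gⁿ = −U_{n−1}·Id + U_n·g,
-- where U is the Lucas sequence of T. If x₀ ≠ 0 then |T| ≥ 2 and |U_n| is strictly increasing, so
-- gⁿ = ±Id forces the x₁, x₂, x₃ coordinates of g to vanish and det g = x₀² = 1 gives g = ±Id.
-- If x₀ = 0, the determinant equation says a x₁² ≡ −1 (mod p). As p ≡ 1 (mod 4), −1 ≡ s² for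
-- some s: the involution x ↦ ±x⁻¹ of {2, …, (p − 1)/2}, a set of odd size, has a fixed point.
-- Hence a ≡ (s/x₁)² would be a quadratic residue.

module Submission where

open import Defs
open import Data.Nat as ℕ using (ℕ; zero; suc; _≤_; _<_; s≤s; z≤n; _∸_; NonZero)
import Data.Nat.Properties as ℕ
import Data.Nat.Divisibility as ℕ
open import Data.Nat.DivMod using (_%_; _/_; m≡m%n+[m/n]*n)
open import Data.Nat.Primality using (Prime; prime⇒nonZero; prime⇒nonTrivial; euclidsLemma)
open import Data.Nat.Coprimality using (prime⇒coprime; coprime-Bézout)
open import Data.Nat.GCD using (module Bézout)
import Data.Nat.Tactic.RingSolver as ℕSolver
open import Data.Integer using (ℤ; +_; -[1+_]; +[1+_]; 0ℤ; 1ℤ; -1ℤ; _+_; _-_; _*_; -_; ∣_∣; _%ℕ_; _/ℕ_)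
import Data.Integer.Properties as ℤ
open import Data.Integer.DivMod using (a≡a%ℕn+[a/ℕn]*n; n%ℕd<d)
open import Data.Integer.Divisibility.Signed
import Data.Integer.Divisibility as Unsigned
open import Data.Integer.Tactic.RingSolver using (solve-∀)
open import Data.List using (List; []; _∷_; _++_; length; applyUpTo)
open import Data.List.Properties using (length-applyUpTo)
open import Data.List.Membership.Propositional using (_∈_)
open import Data.List.Membership.Propositional.Properties using (∈-∃++; ∈-applyUpTo⁺; ∈-applyUpTo⁻)
open import Data.List.Relation.Unary.Any using (here; there)
open import Data.List.Relation.Unary.Unique.Propositional using (Unique; _∷_)
open import Data.List.Relation.Unary.Unique.Propositional.Properties
  using (Unique[x∷xs]⇒x∉xs; drop⁺; applyUpTo⁺₁)
open import Data.List.Relation.Binary.Permutation.Propositional using (_↭_; ↭-sym; ↭⇒↭ₛ)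
open import Data.List.Relation.Binary.Permutation.Propositional.Properties
  using (shift; ∈-resp-↭; ↭-length)
import Data.List.Relation.Binary.Permutation.Setoid.Properties as ↭ₛ
open import Data.Product using (∃-syntax; _×_; _,_; proj₁)
open import Data.Sum as Sum using (_⊎_; inj₁; inj₂)
open import Function using (_∘_; _$_)
open import Relation.Binary using (Rel; Symmetric)
open import Relation.Nullary using (¬_; yes; no; contradiction)
open import Relation.Binary.PropositionalEquality
  using (_≡_; _≢_; refl; sym; trans; cong; cong₂; subst; setoid; module ≡-Reasoning)

∈⇒↭∷ : ∀ {a} {A : Set a} {x : A} {xs} → x ∈ xs → ∃[ ws ] xs ↭ x ∷ ws
∈⇒↭∷ x∈xs with ys , zs , refl ← ∈-∃++ x∈xs = ys ++ zs , shift _ ys zs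

module _ {a ℓ} {A : Set a} (R : Rel A ℓ) where

  Total-on : List A → Set _
  Total-on xs = ∀ {x} → x ∈ xs → ∃[ y ] y ∈ xs × R x y

  Functional-on : List A → Set _
  Functional-on xs = ∀ {x y z} → x ∈ xs → y ∈ xs → z ∈ xs → R x y → R x z → y ≡ z

  -- Removing the head and its partner preserves the hypotheses and the parity of the length.
  odd-matching⇒loop : Symmetric R → ∀ k {xs} → length xs ≡ suc (k ℕ.+ k) → Unique xs →
    Total-on xs → Functional-on xs → ∃[ x ] x ∈ xs × R x x
  odd-matching⇒loop _ zero {x ∷ []} _ _ total _ with total (here refl)
  ... | _ , here refl , Rxx = x , here refl , Rxx
  odd-matching⇒loop R-sym (suc k) {x ∷ rest} len uniq@(_ ∷ uniq-rest) total functional with total (here refl)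
  ... | _ , here refl , Rxx = x , here refl , Rxx
  ... | x' , there x'∈rest , Rxx' with ws , σ ← ∈⇒↭∷ x'∈rest =
    let z , z∈ws , Rzz = odd-matching⇒loop R-sym k len-ws uniq-ws total-ws functional-ws
    in z , ws⊆xs z∈ws , Rzz
    where
    uniq-x'ws : Unique (x' ∷ ws)
    uniq-x'ws = ↭ₛ.Unique-resp-↭ (setoid _) (↭⇒↭ₛ σ) uniq-rest
    uniq-ws : Unique ws
    uniq-ws = drop⁺ 1 uniq-x'ws
    len-ws : length ws ≡ suc (k ℕ.+ k)
    len-ws = trans (ℕ.suc-injective (trans (sym (↭-length σ)) (ℕ.suc-injective len))) (ℕ.+-suc k k)
    ws⊆rest : ∀ {y} → y ∈ ws → y ∈ rest
    ws⊆rest y∈ws = ∈-resp-↭ (↭-sym σ) (there y∈ws)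
    ws⊆xs : ∀ {y} → y ∈ ws → y ∈ x ∷ rest
    ws⊆xs y∈ws = there (ws⊆rest y∈ws)
    total-ws : Total-on ws
    total-ws {y} y∈ws with total (ws⊆xs y∈ws)
    ... | _ , here refl , Ryx =
      contradiction (subst (_∈ ws) y≡x' y∈ws) (Unique[x∷xs]⇒x∉xs uniq-x'ws)
      where
      y≡x' : y ≡ x'
      y≡x' = functional (here refl) (ws⊆xs y∈ws) (there x'∈rest) (R-sym Ryx) Rxx'
    ... | y' , there y'∈rest , Ryy' with ∈-resp-↭ σ y'∈rest
    ...   | there y'∈ws = y' , y'∈ws , Ryy'
    ...   | here refl =
      contradiction (subst (_∈ rest) y≡x (ws⊆rest y∈ws)) (Unique[x∷xs]⇒x∉xs uniq)
      where
      y≡x : y ≡ x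
      y≡x = functional (there x'∈rest) (ws⊆xs y∈ws) (here refl) (R-sym Ryy') (R-sym Rxx')
    functional-ws : Functional-on ws
    functional-ws x∈ y∈ z∈ = functional (ws⊆xs x∈) (ws⊆xs y∈) (ws⊆xs z∈)

trace : Mat → ℤ
trace g = x0 g + x0 g

lincomb : Mat → ℤ → ℤ → Mat
lincomb g c d = mat (c + d * x0 g) (d * x1 g) (d * x2 g) (d * x3 g)

mat-cong : ∀ {u0 u1 u2 u3 v0 v1 v2 v3} →
  u0 ≡ v0 → u1 ≡ v1 → u2 ≡ v2 → u3 ≡ v3 → mat u0 u1 u2 u3 ≡ mat v0 v1 v2 v3
mat-cong refl refl refl refl = refl

cayley-hamilton : ∀ a p g c d →
  mul a p g (lincomb g c d) ≡ lincomb g (- (d * det a p g)) (c + trace g * d)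
cayley-hamilton a p (mat x0 x1 x2 x3) c d = mat-cong
  (real-part (+ a) (+ p) x0 x1 x2 x3 c d)
  (i-part (+ p) x0 x1 x2 x3 c d)
  (j-part (+ a) x0 x1 x2 x3 c d)
  (ij-part x0 x1 x2 x3 c d)
  where
  real-part : ∀ A P x0 x1 x2 x3 c d →
    x0 * (c + d * x0) + A * (x1 * (d * x1)) + P * (x2 * (d * x2)) - A * P * (x3 * (d * x3))
    ≡ - (d * (x0 * x0 - A * (x1 * x1) - P * (x2 * x2) + A * P * (x3 * x3)))
      + (c + (x0 + x0) * d) * x0
  real-part = solve-∀
  i-part : ∀ P x0 x1 x2 x3 c d →
    x0 * (d * x1) + x1 * (c + d * x0) - P * (x2 * (d * x3)) + P * (x3 * (d * x2))
    ≡ (c + (x0 + x0) * d) * x1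
  i-part = solve-∀
  j-part : ∀ A x0 x1 x2 x3 c d →
    x0 * (d * x2) + x2 * (c + d * x0) + A * (x1 * (d * x3)) - A * (x3 * (d * x1))
    ≡ (c + (x0 + x0) * d) * x2
  j-part = solve-∀
  ij-part : ∀ x0 x1 x2 x3 c d →
    x0 * (d * x3) + x3 * (c + d * x0) + x1 * (d * x2) - x2 * (d * x1)
    ≡ (c + (x0 + x0) * d) * x3
  ij-part = solve-∀

cayley-hamilton-det1 : ∀ a p g → det a p g ≡ 1ℤ → ∀ c d →
  mul a p g (lincomb g c d) ≡ lincomb g (- d) (c + trace g * d)
cayley-hamilton-det1 a p g det≡1 c d = begin
  mul a p g (lincomb g c d)                            ≡⟨ cayley-hamilton a p g c d ⟩
  lincomb g (- (d * det a p g)) (c + trace g * d)      ≡⟨ cong (λ e → lincomb g (- (d * e)) (c + trace g * d)) det≡1 ⟩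
  lincomb g (- (d * 1ℤ)) (c + trace g * d)             ≡⟨ cong (λ e → lincomb g (- e) (c + trace g * d)) (ℤ.*-identityʳ d) ⟩
  lincomb g (- d) (c + trace g * d)                    ∎
  where open ≡-Reasoning

lucasU : ℤ → ℕ → ℤ
lucasU T zero          = 0ℤ
lucasU T (suc zero)    = 1ℤ
lucasU T (suc (suc n)) = T * lucasU T (suc n) - lucasU T n

pow-lucasU : ∀ a p g → det a p g ≡ 1ℤ → ∀ n →
  pow a p g (suc n) ≡ lincomb g (- lucasU (trace g) n) (lucasU (trace g) (suc n))
pow-lucasU a p g det≡1 zero =
  trans (cayley-hamilton-det1 a p g det≡1 1ℤ 0ℤ) (cong (λ e → lincomb g 0ℤ (1ℤ + e)) (ℤ.*-zeroʳ (trace g)))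
pow-lucasU a p g det≡1 (suc n) = begin
  mul a p g (pow a p g (suc n))           ≡⟨ cong (mul a p g) (pow-lucasU a p g det≡1 n) ⟩
  mul a p g (lincomb g (- U n) (U (suc n))) ≡⟨ cayley-hamilton-det1 a p g det≡1 (- U n) (U (suc n)) ⟩
  lincomb g (- U (suc n)) (- U n + trace g * U (suc n)) ≡⟨ cong (lincomb g (- U (suc n))) (ℤ.+-comm (- U n) _) ⟩
  lincomb g (- U (suc n)) (U (suc (suc n))) ∎
  where
  open ≡-Reasoning
  U = lucasU (trace g)

lucasU-strictMono : ∀ {T} → 2 ℕ.≤ ∣ T ∣ → ∀ n → ∣ lucasU T n ∣ ℕ.< ∣ lucasU T (suc n) ∣
lucasU-strictMono 2≤∣T∣ zero = s≤s z≤n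
lucasU-strictMono {T} 2≤∣T∣ (suc n) = ℕ.+-cancelˡ-< b b c (begin-strict
  b ℕ.+ b                   ≡⟨ cong (b ℕ.+_) (ℕ.+-identityʳ b) ⟨
  2 ℕ.* b                   ≤⟨ ℕ.*-monoˡ-≤ b 2≤∣T∣ ⟩
  ∣ T ∣ ℕ.* b               ≡⟨ ℤ.abs-* T (U (suc n)) ⟨
  ∣ T * U (suc n) ∣         ≡⟨ cong ∣_∣ (recurrence T (U (suc n)) (U n)) ⟩
  ∣ U (suc (suc n)) + U n ∣ ≤⟨ ℤ.∣i+j∣≤∣i∣+∣j∣ (U (suc (suc n))) (U n) ⟩
  c ℕ.+ a                   <⟨ ℕ.+-monoʳ-< c (lucasU-strictMono 2≤∣T∣ n) ⟩
  c ℕ.+ b                   ≡⟨ ℕ.+-comm c b ⟩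
  b ℕ.+ c                   ∎)
  where
  open ℕ.≤-Reasoning
  U = lucasU T
  a = ∣ U n ∣
  b = ∣ U (suc n) ∣
  c = ∣ U (suc (suc n)) ∣
  recurrence : ∀ T u v → T * u ≡ (T * u - v) + v
  recurrence = solve-∀

lucasU-nonZero : ∀ {T} → 2 ℕ.≤ ∣ T ∣ → ∀ n → lucasU T (suc n) ≢ 0ℤ
lucasU-nonZero {T} 2≤∣T∣ n U≡0 = ℕ.n≮0 (subst (λ u → ∣ lucasU T n ∣ ℕ.< ∣ u ∣) U≡0 (lucasU-strictMono 2≤∣T∣ n))

2≤∣trace∣ : ∀ g → x0 g ≢ 0ℤ → 2 ℕ.≤ ∣ trace g ∣
2≤∣trace∣ (mat (+ zero) _ _ _) x0≢0 = contradiction refl x0≢0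
2≤∣trace∣ (mat +[1+ n ] _ _ _) _  = s≤s (ℕ.≤-trans (s≤s z≤n) (ℕ.m≤n+m (suc n) n))
2≤∣trace∣ (mat -[1+ n ] _ _ _) _  = s≤s (s≤s z≤n)

±Id : Mat → Set
±Id h = h ≡ idM ⊎ h ≡ negIdM

IsScalar : Mat → Set
IsScalar h = x1 h ≡ 0ℤ × x2 h ≡ 0ℤ × x3 h ≡ 0ℤ

±Id⇒scalar : ∀ {h} → ±Id h → IsScalar h
±Id⇒scalar (inj₁ refl) = refl , refl , refl
±Id⇒scalar (inj₂ refl) = refl , refl , refl

scalar-lincomb⇒scalar : ∀ g c {d} → d ≢ 0ℤ → IsScalar (lincomb g c d) → IsScalar g
scalar-lincomb⇒scalar g c {d} d≢0 (e1 , e2 , e3) = cancel e1 , cancel e2 , cancel e3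
  where
  cancel : ∀ {x} → d * x ≡ 0ℤ → x ≡ 0ℤ
  cancel dx≡0 = Sum.fromInj₂ (λ d≡0 → contradiction d≡0 d≢0) (ℤ.i*j≡0⇒i≡0∨j≡0 d dx≡0)

*-self≡1⇒±1 : ∀ x → x * x ≡ 1ℤ → x ≡ 1ℤ ⊎ x ≡ -1ℤ
*-self≡1⇒±1 x x²≡1 with ℕ.m*n≡1⇒m≡1 ∣ x ∣ ∣ x ∣ (trans (sym (ℤ.abs-* x x)) (cong ∣_∣ x²≡1))
*-self≡1⇒±1 (+ _)    _ | refl = inj₁ refl
*-self≡1⇒±1 -[1+ _ ] _ | refl = inj₂ refl

scalar∧det≡1⇒±Id : ∀ a p g → IsScalar g → det a p g ≡ 1ℤ → ±Id g
scalar∧det≡1⇒±Id a p (mat x0 _ _ _) (refl , refl , refl) det≡1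
  with *-self≡1⇒±1 x0 (trans (sym (det-scalar (+ a) (+ p) x0)) det≡1)
  where
  det-scalar : ∀ A P x → x * x - A * (0ℤ * 0ℤ) - P * (0ℤ * 0ℤ) + A * P * (0ℤ * 0ℤ) ≡ x * x
  det-scalar = solve-∀
... | inj₁ refl = inj₁ refl
... | inj₂ refl = inj₂ refl

finiteOrder⇒±Id⊎traceless : ∀ a p g → det a p g ≡ 1ℤ → ∀ n → ±Id (pow a p g (suc n)) →
  ±Id g ⊎ x0 g ≡ 0ℤ
finiteOrder⇒±Id⊎traceless a p g det≡1 n gⁿ≡±1 with x0 g ℤ.≟ 0ℤ
... | yes x0≡0 = inj₂ x0≡0
... | no  x0≢0 = inj₁ (scalar∧det≡1⇒±Id a p g g-scalar det≡1)
  where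
  g-scalar : IsScalar g
  g-scalar = scalar-lincomb⇒scalar g (- lucasU (trace g) n) (lucasU-nonZero (2≤∣trace∣ g x0≢0) n)
    (subst IsScalar (pow-lucasU a p g det≡1 n) (±Id⇒scalar gⁿ≡±1))

module _ {p} (p-prime : Prime p) where

  private instance
    p-nonZero = prime⇒nonZero p-prime
    p-nonTrivial = prime⇒nonTrivial p-prime

  euclidsLemmaℤ : ∀ {i j} → + p ∣ i * j → (+ p ∣ i) ⊎ (+ p ∣ j)
  euclidsLemmaℤ {i} {j} p∣ij = Sum.map ∣ᵤ⇒∣ ∣ᵤ⇒∣
    (euclidsLemma ∣ i ∣ ∣ j ∣ p-prime (subst (p ℕ.∣_) (ℤ.abs-* i j) (∣⇒∣ᵤ p∣ij)))

  ∣∧∣i∣<p⇒≡0 : ∀ {i} → + p ∣ i → ∣ i ∣ < p → i ≡ 0ℤ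
  ∣∧∣i∣<p⇒≡0 {i} p∣i ∣i∣<p = ℤ.∣i∣≡0⇒i≡0 (∣∧<⇒≡0 (∣⇒∣ᵤ p∣i) ∣i∣<p)
    where
    ∣∧<⇒≡0 : ∀ {n} → p ℕ.∣ n → n < p → n ≡ 0
    ∣∧<⇒≡0 {zero}  _   _   = refl
    ∣∧<⇒≡0 {suc _} p∣n n<p = contradiction p∣n (ℕ.>⇒∤ n<p)

  p∤1 : ¬ + p ∣ 1ℤ
  p∤1 p∣1 with () ← ∣∧∣i∣<p⇒≡0 p∣1 (ℕ.nonTrivial⇒n>1 p)

  infix 4 _≡±_ _·_≡±1

  record _≡±_ (x y : ℤ) : Set where
    constructor ≡±-by
    field p∣[x-y][x+y] : + p ∣ (x - y) * (x + y)

  ≡±-sym : ∀ {x y} → x ≡± y → y ≡± x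
  ≡±-sym {x} {y} (≡±-by p∣[x-y][x+y]) = ≡±-by (subst (+ p ∣_) (swap x y) (∣m⇒∣-m p∣[x-y][x+y]))
    where
    swap : ∀ x y → - ((x - y) * (x + y)) ≡ (y - x) * (y + x)
    swap = solve-∀

  record _·_≡±1 (x y : ℤ) : Set where
    constructor ·≡±1-by
    field p∣[xy]²-1 : + p ∣ (x * y) * (x * y) - 1ℤ

  ·≡±1-sym : ∀ {x y} → x · y ≡±1 → y · x ≡±1
  ·≡±1-sym {x} {y} (·≡±1-by p∣[xy]²-1) = ·≡±1-by (subst (λ z → + p ∣ z * z - 1ℤ) (ℤ.*-comm x y) p∣[xy]²-1)

  ·≡±1-resp-≡± : ∀ {x y z} → y ≡± z → x · y ≡±1 → x · z ≡±1
  ·≡±1-resp-≡± {x} {y} {z} (≡±-by y≡±z) (·≡±1-by xy≡±1) =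
    ·≡±1-by (subst (+ p ∣_) (substitute x y z) (∣m∣n⇒∣m-n xy≡±1 (∣n⇒∣m*n (x * x) y≡±z)))
    where
    substitute : ∀ x y z → ((x * y) * (x * y) - 1ℤ) - (x * x) * ((y - z) * (y + z)) ≡ (x * z) * (x * z) - 1ℤ
    substitute = solve-∀

  ·≡±1-unique : ∀ {x y z} → ¬ + p ∣ x → x · y ≡±1 → x · z ≡±1 → y ≡± z
  ·≡±1-unique {x} {y} {z} p∤x (·≡±1-by xy≡±1) (·≡±1-by xz≡±1)
    with euclidsLemmaℤ (subst (+ p ∣_) (difference x y z) (∣m∣n⇒∣m-n xy≡±1 xz≡±1))
    where
    difference : ∀ x y z → ((x * y) * (x * y) - 1ℤ) - ((x * z) * (x * z) - 1ℤ) ≡ (x * x) * ((y - z) * (y + z))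
    difference = solve-∀
  ... | inj₁ p∣x² = contradiction (Sum.reduce (euclidsLemmaℤ p∣x²)) p∤x
  ... | inj₂ y≡±z = ≡±-by y≡±z

  ·≡±1⇒∤ : ∀ {x y} → x · y ≡±1 → ¬ + p ∣ y
  ·≡±1⇒∤ {x} {y} (·≡±1-by xy≡±1) p∣y = p∤1 (∣m⇒∣-m (∣m+n∣m⇒∣n xy≡±1 p∣xyxy))
    where
    p∣xyxy : + p ∣ (x * y) * (x * y)
    p∣xyxy = ∣m⇒∣m*n (x * y) (∣n⇒∣m*n x p∣y)

  ≡1∨≡-1⇒·≡±1 : ∀ x y → (+ p ∣ x * y - 1ℤ) ⊎ (+ p ∣ x * y + 1ℤ) → x · y ≡±1
  ≡1∨≡-1⇒·≡±1 x y p∣xy∓1 = ·≡±1-by $ subst (+ p ∣_) (factor (x * y))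
    (Sum.[ ∣m⇒∣m*n (x * y + 1ℤ) , ∣n⇒∣m*n (x * y - 1ℤ) ]′ p∣xy∓1)
    where
    factor : ∀ u → (u - 1ℤ) * (u + 1ℤ) ≡ u * u - 1ℤ
    factor = solve-∀

  inverse-of-small : ∀ n .{{_ : NonZero n}} → n < p → ∃[ y ] (+ n) · (+ y) ≡±1
  inverse-of-small n n<p with coprime-Bézout (prime⇒coprime p-prime n<p)
  ... | Bézout.+- q y eq = y , ≡1∨≡-1⇒·≡±1 (+ n) (+ y) (inj₂ (divides (+ q) (begin
    + n * + y + 1ℤ   ≡⟨ ℤ.+-comm (+ n * + y) 1ℤ ⟩
    1ℤ + + n * + y   ≡⟨ cong (λ k → 1ℤ + k) (trans (ℤ.*-comm (+ n) (+ y)) (sym (ℤ.pos-* y n))) ⟩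
    + (1 ℕ.+ y ℕ.* n) ≡⟨ cong +_ eq ⟩
    + (q ℕ.* p)       ≡⟨ ℤ.pos-* q p ⟩
    + q * + p         ∎)))
    where open ≡-Reasoning
  ... | Bézout.-+ q y eq = y , ≡1∨≡-1⇒·≡±1 (+ n) (+ y) (inj₁ (divides (+ q) (begin
    + n * + y - 1ℤ          ≡⟨ cong (_- 1ℤ) (trans (ℤ.*-comm (+ n) (+ y)) (sym (ℤ.pos-* y n))) ⟩
    + (y ℕ.* n) - 1ℤ        ≡⟨ cong (λ k → + k - 1ℤ) eq ⟨
    1ℤ + + (q ℕ.* p) - 1ℤ   ≡⟨ 1+u-1≡u (+ (q ℕ.* p)) ⟩
    + (q ℕ.* p)             ≡⟨ ℤ.pos-* q p ⟩
    + q * + p               ∎)))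
    where
    open ≡-Reasoning
    1+u-1≡u : ∀ u → 1ℤ + u - 1ℤ ≡ u
    1+u-1≡u = solve-∀

  module HalfSystem (m : ℕ) (p≡2m+1 : p ≡ suc (m ℕ.+ m)) where

    InHalf : ℕ → Set
    InHalf r = 1 ≤ r × r ≤ m

    m+m<p : m ℕ.+ m < p
    m+m<p = subst (m ℕ.+ m <_) (sym p≡2m+1) ℕ.≤-refl

    ≤m⇒<p : ∀ {r} → r ≤ m → r < p
    ≤m⇒<p r≤m = ℕ.≤-<-trans (ℕ.≤-trans r≤m (ℕ.m≤m+n m m)) m+m<p

    inHalf⇒p∤ : ∀ {r} → InHalf r → ¬ + p ∣ + r
    inHalf⇒p∤ (s≤s z≤n , r≤m) p∣r with () ← ∣∧∣i∣<p⇒≡0 p∣r (≤m⇒<p r≤m)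

    representative : ∀ {x} → ¬ + p ∣ x → ∃[ r ] InHalf r × x ≡± + r
    representative {x} p∤x with x %ℕ p | n%ℕd<d x p | a≡a%ℕn+[a/ℕn]*n x p
    ... | zero  | _    | x≡r+qp = contradiction (divides (x /ℕ p) (trans x≡r+qp (ℤ.+-identityˡ _))) p∤x
    ... | suc t | r<p | x≡r+qp with suc t ℕ.≤? m
    ...   | yes r≤m = suc t , (s≤s z≤n , r≤m) , ≡±-by (
      ∣m⇒∣m*n (x + + suc t) (divides (x /ℕ p) (trans (cong (_- + suc t) x≡r+qp) (r+u-r≡u (+ suc t) _))))
      where
      r+u-r≡u : ∀ r u → r + u - r ≡ u
      r+u-r≡u = solve-∀
    ...   | no r≰m = p ∸ suc t , (ℕ.m<n⇒0<n∸m r<p , p-r≤m) , ≡±-by (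
      ∣n⇒∣m*n (x - + (p ∸ suc t)) (divides (x /ℕ p + 1ℤ) (begin
        x + + (p ∸ suc t)                      ≡⟨ cong₂ _+_ x≡r+qp (sym p-r≡) ⟩
        (+ suc t + x /ℕ p * + p) + (+ p - + suc t) ≡⟨ flip-identity (+ suc t) (x /ℕ p) (+ p) ⟩
        (x /ℕ p + 1ℤ) * + p                    ∎)))
      where
      open ≡-Reasoning
      p-r≡ : + p - + suc t ≡ + (p ∸ suc t)
      p-r≡ = trans (ℤ.m-n≡m⊖n p (suc t)) (ℤ.⊖-≥ (ℕ.<⇒≤ r<p))
      p-r≤m : p ∸ suc t ≤ m
      p-r≤m = ℕ.≤-trans (ℕ.∸-monoʳ-≤ p (ℕ.≰⇒> r≰m))
        (ℕ.≤-reflexive (trans (cong (_∸ suc m) p≡2m+1) (ℕ.m+n∸m≡n m m)))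
      flip-identity : ∀ r q P → (r + q * P) + (P - r) ≡ (q + 1ℤ) * P
      flip-identity = solve-∀

    ≡±-injective : ∀ {y z} → InHalf y → InHalf z → + y ≡± + z → y ≡ z
    ≡±-injective {suc y} {z} (s≤s z≤n , y≤m) (_ , z≤m) (≡±-by y≡±z) with euclidsLemmaℤ y≡±z
    ... | inj₁ p∣y-z = ℤ.+-injective (ℤ.i-j≡0⇒i≡j _ _ (∣∧∣i∣<p⇒≡0 p∣y-z ∣y-z∣<p))
      where
      ∣y-z∣<p : ∣ + suc y - + z ∣ < p
      ∣y-z∣<p = ℕ.≤-<-trans
        (subst (_≤ suc y ℕ.⊔ z) (cong ∣_∣ (sym (ℤ.m-n≡m⊖n (suc y) z))) (ℤ.∣m⊝n∣≤m⊔n (suc y) z))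
        (≤m⇒<p (ℕ.⊔-lub y≤m z≤m))
    ... | inj₂ p∣y+z with () ← ∣∧∣i∣<p⇒≡0 p∣y+z (ℕ.≤-<-trans (ℕ.+-mono-≤ y≤m z≤m) m+m<p)

    inverse : ∀ {x} → ¬ + p ∣ x → ∃[ y ] x · y ≡±1
    inverse p∤x =
      let r , (1≤r , r≤m) , x≡±r = representative p∤x
          y , r·y≡±1 = inverse-of-small r {{ℕ.>-nonZero 1≤r}} (≤m⇒<p r≤m)
      in + y , ·≡±1-sym (·≡±1-resp-≡± (≡±-sym x≡±r) (·≡±1-sym r·y≡±1))

    partner : ∀ {x} → InHalf x → ∃[ z ] InHalf z × + x · + z ≡±1
    partner {x} (1≤x , x≤m) =
      let y , x·y≡±1 = inverse-of-small x {{ℕ.>-nonZero 1≤x}} (≤m⇒<p x≤m)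
          z , z∈half , y≡±z = representative (·≡±1⇒∤ x·y≡±1)
      in z , z∈half , ·≡±1-resp-≡± y≡±z x·y≡±1

    ·1≡±1⇒≡1 : ∀ {x} → InHalf x → + x · 1ℤ ≡±1 → x ≡ 1
    ·1≡±1⇒≡1 {x} x∈half@(1≤x , x≤m) (·≡±1-by x·1≡±1) =
      ≡±-injective x∈half (ℕ.≤-refl , ℕ.≤-trans 1≤x x≤m) (≡±-by (subst (+ p ∣_) (factor (+ x)) x·1≡±1))
      where
      factor : ∀ u → (u * 1ℤ) * (u * 1ℤ) - 1ℤ ≡ (u - 1ℤ) * (u + 1ℤ)
      factor = solve-∀

    self-inverse⇒p∣x²+1 : ∀ {x} → InHalf x → x ≢ 1 → + x · + x ≡±1 → + p ∣ + x * + x + 1ℤ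
    self-inverse⇒p∣x²+1 {x} x∈half x≢1 (·≡±1-by x·x≡±1) with euclidsLemmaℤ (subst (+ p ∣_) (factor (+ x)) x·x≡±1)
      where
      factor : ∀ u → (u * u) * (u * u) - 1ℤ ≡ ((u * 1ℤ) * (u * 1ℤ) - 1ℤ) * (u * u + 1ℤ)
      factor = solve-∀
    ... | inj₁ x·1≡±1 = contradiction (·1≡±1⇒≡1 x∈half (·≡±1-by x·1≡±1)) x≢1
    ... | inj₂ p∣x²+1 = p∣x²+1

  p≡1-mod-4⇒p≡4k+5 : p % 4 ≡ 1 → ∃[ k ] p ≡ suc (2 ℕ.+ (k ℕ.+ k) ℕ.+ (2 ℕ.+ (k ℕ.+ k)))
  p≡1-mod-4⇒p≡4k+5 p%4≡1 with p / 4 | m≡m%n+[m/n]*n p 4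
  ... | zero  | p≡ = contradiction (trans p≡ (cong (ℕ._+ 0) p%4≡1)) (ℕ.nonTrivial⇒≢1 {{p-nonTrivial}})
  ... | suc k | p≡ = k , trans p≡ (trans (cong (ℕ._+ suc k ℕ.* 4) p%4≡1) (rearrange k))
    where
    rearrange : ∀ k → 1 ℕ.+ suc k ℕ.* 4 ≡ suc (2 ℕ.+ (k ℕ.+ k) ℕ.+ (2 ℕ.+ (k ℕ.+ k)))
    rearrange = ℕSolver.solve-∀

  -1-isSquare : p % 4 ≡ 1 → ∃[ s ] + p ∣ s * s + 1ℤ
  -1-isSquare p%4≡1 with k , p≡2m+1 ← p≡1-mod-4⇒p≡4k+5 p%4≡1 =
    let x , x∈L , x·x≡±1 = odd-matching⇒loop R ·≡±1-sym k (length-applyUpTo (2 ℕ.+_) _) unique-L total functional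
    in + x , self-inverse⇒p∣x²+1 (∈L⇒inHalf x∈L) (∈L⇒≢1 x∈L) x·x≡±1
    where
    m = 2 ℕ.+ (k ℕ.+ k)
    open HalfSystem m p≡2m+1
    R : ℕ → ℕ → Set
    R x y = + x · + y ≡±1
    L = applyUpTo (2 ℕ.+_) (suc (k ℕ.+ k))
    unique-L : Unique L
    unique-L = applyUpTo⁺₁ (2 ℕ.+_) _ (λ i<j _ → ℕ.<⇒≢ i<j ∘ ℕ.+-cancelˡ-≡ 2 _ _)
    ∈L⁻ : ∀ {x} → x ∈ L → 2 ≤ x × x ≤ m
    ∈L⁻ x∈L with _ , i<n , refl ← ∈-applyUpTo⁻ (2 ℕ.+_) x∈L = s≤s (s≤s z≤n) , s≤s (s≤s (ℕ.s≤s⁻¹ i<n))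
    ∈L⁺ : ∀ {x} → 2 ≤ x → x ≤ m → x ∈ L
    ∈L⁺ (s≤s (s≤s _)) (s≤s (s≤s i≤2k)) = ∈-applyUpTo⁺ (2 ℕ.+_) (s≤s i≤2k)
    ∈L⇒inHalf : ∀ {x} → x ∈ L → InHalf x
    ∈L⇒inHalf x∈L with 2≤x , x≤m ← ∈L⁻ x∈L = ℕ.<⇒≤ 2≤x , x≤m
    ∈L⇒≢1 : ∀ {x} → x ∈ L → x ≢ 1
    ∈L⇒≢1 x∈L x≡1 = ℕ.<⇒≢ (proj₁ (∈L⁻ x∈L)) (sym x≡1)
    total : Total-on R L
    total {x} x∈L =
      let z , (1≤z , z≤m) , x·z≡±1 = partner (∈L⇒inHalf x∈L)
          1≢z : 1 ≢ z
          1≢z 1≡z = ∈L⇒≢1 x∈L (·1≡±1⇒≡1 (∈L⇒inHalf x∈L) (subst (λ w → + x · + w ≡±1) (sym 1≡z) x·z≡±1))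
      in z , ∈L⁺ (ℕ.≤∧≢⇒< 1≤z 1≢z) z≤m , x·z≡±1
    functional : Functional-on R L
    functional x∈L y∈L z∈L x·y≡±1 x·z≡±1 = ≡±-injective (∈L⇒inHalf y∈L) (∈L⇒inHalf z∈L)
      (·≡±1-unique (inHalf⇒p∤ (∈L⇒inHalf x∈L)) x·y≡±1 x·z≡±1)

  traceless⇒residue : ∀ {a} → p % 4 ≡ 1 → ∀ g → det a p g ≡ 1ℤ → x0 g ≡ 0ℤ →
    ∃[ x ] (+ p) Unsigned.∣ (x * x - + a)
  traceless⇒residue {a} p%4≡1 (mat _ x1 x2 x3) det≡1 refl =
    let k , p≡2m+1 = p≡1-mod-4⇒p≡4k+5 p%4≡1
        y , ·≡±1-by p∣[x1y]²-1 = HalfSystem.inverse (2 ℕ.+ (k ℕ.+ k)) p≡2m+1 p∤x1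
        s , p∣s²+1 = -1-isSquare p%4≡1
    in s * y , ∣⇒∣ᵤ (subst (+ p ∣_) (residue-identity s y x1 (+ a))
         (∣m∣n⇒∣m+n (∣m∣n⇒∣m-n (∣m⇒∣m*n (y * y) p∣s²+1) (∣m⇒∣m*n (y * y) p∣ax1²+1))
                    (∣n⇒∣m*n (+ a) p∣[x1y]²-1)))
    where
    p∣ax1²+1 : + p ∣ + a * (x1 * x1) + 1ℤ
    p∣ax1²+1 = divides (+ a * (x3 * x3) - x2 * x2) (begin
      + a * (x1 * x1) + 1ℤ                         ≡⟨ cong (λ e → + a * (x1 * x1) + e) det≡1 ⟨
      + a * (x1 * x1) + det a p (mat 0ℤ x1 x2 x3)  ≡⟨ det-identity (+ a) (+ p) x1 x2 x3 ⟩
      (+ a * (x3 * x3) - x2 * x2) * + p            ∎)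
      where
      open ≡-Reasoning
      det-identity : ∀ A P x1 x2 x3 →
        A * (x1 * x1) + (0ℤ * 0ℤ - A * (x1 * x1) - P * (x2 * x2) + A * P * (x3 * x3)) ≡ (A * (x3 * x3) - x2 * x2) * P
      det-identity = solve-∀
    p∤x1 : ¬ + p ∣ x1
    p∤x1 p∣x1 = p∤1 (∣m+n∣m⇒∣n p∣ax1²+1 (∣n⇒∣m*n (+ a) (∣m⇒∣m*n x1 p∣x1)))
    residue-identity : ∀ s y x A →
      (s * s + 1ℤ) * (y * y) - (A * (x * x) + 1ℤ) * (y * y) + A * ((x * y) * (x * y) - 1ℤ) ≡ (s * y) * (s * y) - A
    residue-identity = solve-∀

mainTheorem1 : (p a : ℕ) → Prime p → p % 4 ≡ 1 → 0 < a → a < p → NonResidue p a →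
    (g : Mat) → det a p g ≡ + 1 →
    (n : ℕ) → 1 ≤ n → (pow a p g n ≡ idM ⊎ pow a p g n ≡ negIdM) →
    g ≡ idM ⊎ g ≡ negIdM
mainTheorem1 p a p-prime p%4≡1 _ _ nonResidue g det≡1 (suc n) _ gⁿ≡±1
  with finiteOrder⇒±Id⊎traceless a p g det≡1 n gⁿ≡±1
... | inj₁ g≡±1     = g≡±1
... | inj₂ trace≡0 = contradiction (traceless⇒residue p-prime p%4≡1 g det≡1 trace≡0) nonResidue
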